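{- Let $\mathbf v\in\{0,1\}^{\mathbb N}$ have well distributed occurrences modulo $2$ (WELLDOC(2)) and let its language be closed under reversal. If $\mathbf u\in\{0,1\}^{\mathbb N}$ satisfies $S(\mathbf u)=\mathbf v$, then the language of $\mathbf u$ is closed under all elements of $H=\{\mathrm{id},R,E,RE\}$.
   Context: $R$ is reversal; $E$ is the antimorphism $E(w_0\cdots w_n)=\overline{w_n}\cdots\overline{w_0}$ with $\overline0=1,\overline1=0$. A language (set of finite factors) is closed under $\mu$ if it contains $\mu(w)$ for each of its words $w$. $S(u_0u_1\cdots)=v_1v_2\cdots$ with $v_i=(u_{i-1}+u_i)\bmod 2$. For a finite word $x$ and letter $a$, $|x|_a$ is the number of occurrences of $a$ in $x$. $\mathbf v$ has WELLDOC(2) if for every factor $w$ of $\mathbf v$, $\{(|x|_0 \bmod 2,\ |x|_1\bmod 2): xw \text{ is a prefix of } \mathbf v\}=\mathbb Z_2^2$. -}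

module Defs where

open import Data.Bool using (Bool; true; false; not; _xor_)
open import Data.Nat using (ℕ; zero; suc; _+_)
open import Data.List using (List; []; _∷_; length; reverse; map)
open import Data.Product using (∃; _×_; _,_)
open import Relation.Binary.PropositionalEquality using (_≡_)

-- Letters: false = 0, true = 1.  Infinite words over {0,1} indexed by ℕ.
InfWord : Set
InfWord = ℕ → Bool

slice : InfWord → ℕ → ℕ → List Bool
slice u i zero    = []
slice u i (suc n) = u i ∷ slice u (suc i) n

Factor : List Bool → InfWord → Set
Factor w u = ∃ λ i → slice u i (length w) ≡ w

-- the map S: S(u)_i = (u_i + u_{i+1}) mod 2  (v_{i+1} = u_i + u_{i+1}, reindexed from 0)
S : InfWord → InfWord
S u i = u i xor u (suc i)

parity : Bool → List Bool → Bool
parity a [] = false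
parity true  (true  ∷ x) = not (parity true x)
parity false (false ∷ x) = not (parity false x)
parity true  (false ∷ x) = parity true x
parity false (true  ∷ x) = parity false x

WELLDOC2 : InfWord → Set
WELLDOC2 v = ∀ w → Factor w v → (p0 p1 : Bool) →
  ∃ λ i → (slice v i (length w) ≡ w)
        × (parity false (slice v 0 i) ≡ p0)
        × (parity true (slice v 0 i) ≡ p1)

E : List Bool → List Bool
E w = reverse (map not w)

R : List Bool → List Bool
R = reverse

ClosedUnder : (List Bool → List Bool) → InfWord → Set
ClosedUnder μ u = ∀ w → Factor w u → Factor (μ w) u

data H : Set where
  idH RH EH REH : H

act : H → List Bool → List Bool
act idH w = w
act RH  w = R w
act EH  w = E w
act REH w = R (E w)

-- Write Δ w for the word of sums of adjacent letters of w, so that S(u) = v means that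
-- every factor w of u has Δ w as a factor of v, at the same position. Conversely u is
-- recovered from v by running sums: u_i = u_0 + |v_0 ⋯ v_(i-1)|_1 (mod 2). A factor s of
-- v, occurring at a position i with a prescribed parity of |v_0 ⋯ v_(i-1)|_1 (WELLDOC(2)),
-- therefore lifts to the factor of u starting with any prescribed letter. Hence the
-- factors of u are exactly the words w with Δ w a factor of v. Since Δ (R w) = R (Δ w)
-- and Δ is blind to exchanging 0 and 1, the language of u inherits closure under R from
-- v and is closed under E and RE as well.
module Submission where

open import Defs
open import Data.Bool using (Bool; true; false; not; _xor_)
open import Data.Bool.Properties using (not-involutive; xor-assoc; xor-comm; xor-identityʳ; xor-annihilates-not)
open import Data.Nat using (zero; suc; _+_)
open import Data.Nat.Properties using (+-suc; +-identityʳ)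
open import Data.List using (List; []; _∷_; _∷ʳ_; length; reverse; map)
open import Data.List.Properties using (unfold-reverse; reverse-involutive)
open import Data.List.Scans.Base using (scanl)
open import Data.Product using (_,_)
open import Data.Sum using (_⊎_; inj₁; inj₂)
open import Relation.Binary.PropositionalEquality using (_≡_; refl; sym; trans; cong; cong₂; subst; module ≡-Reasoning)
open ≡-Reasoning

xor-cancelˡ : ∀ a b → a xor (a xor b) ≡ b
xor-cancelˡ false b = refl
xor-cancelˡ true  b = not-involutive b

parity-true-∷ : ∀ x w → parity true (x ∷ w) ≡ x xor parity true w
parity-true-∷ true  w = refl
parity-true-∷ false w = refl

differences : List Bool → List Bool
differences []          = []
differences (x ∷ [])    = []
differences (x ∷ y ∷ w) = (x xor y) ∷ differences (y ∷ w)

length-differences : ∀ x w → length (differences (x ∷ w)) ≡ length w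
length-differences x []      = refl
length-differences x (y ∷ w) = cong suc (length-differences y w)

length-scanl : ∀ {A B : Set} (f : A → B → A) a s → length (scanl f a s) ≡ suc (length s)
length-scanl f a []      = refl
length-scanl f a (c ∷ s) = cong suc (length-scanl f (f a c) s)

differences-scanl : ∀ a s → differences (scanl _xor_ a s) ≡ s
differences-scanl a []      = refl
differences-scanl a (c ∷ s) = cong₂ _∷_ (xor-cancelˡ a c) (differences-scanl (a xor c) s)

scanl-differences : ∀ x w → scanl _xor_ x (differences (x ∷ w)) ≡ x ∷ w
scanl-differences x []      = refl
scanl-differences x (y ∷ w) = cong (x ∷_) (begin
  scanl _xor_ (x xor (x xor y)) (differences (y ∷ w)) ≡⟨ cong (λ b → scanl _xor_ b _) (xor-cancelˡ x y) ⟩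
  scanl _xor_ y (differences (y ∷ w))                 ≡⟨ scanl-differences y w ⟩
  y ∷ w                                               ∎)

differences-map-not : ∀ w → differences (map not w) ≡ differences w
differences-map-not []          = refl
differences-map-not (x ∷ [])    = refl
differences-map-not (x ∷ y ∷ w) = cong₂ _∷_ (xor-annihilates-not x y) (differences-map-not (y ∷ w))

differences-∷ʳ-∷ʳ : ∀ w x y → differences (w ∷ʳ x ∷ʳ y) ≡ differences (w ∷ʳ x) ∷ʳ (x xor y)
differences-∷ʳ-∷ʳ []          x y = refl
differences-∷ʳ-∷ʳ (z ∷ [])    x y = refl
differences-∷ʳ-∷ʳ (z ∷ t ∷ w) x y = cong ((z xor t) ∷_) (differences-∷ʳ-∷ʳ (t ∷ w) x y)

differences-reverse : ∀ w → differences (reverse w) ≡ reverse (differences w)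
differences-reverse []          = refl
differences-reverse (x ∷ [])    = refl
differences-reverse (x ∷ y ∷ w) = begin
  differences (reverse (x ∷ y ∷ w))             ≡⟨ cong differences reverse-x∷y∷w ⟩
  differences (reverse w ∷ʳ y ∷ʳ x)             ≡⟨ differences-∷ʳ-∷ʳ (reverse w) y x ⟩
  differences (reverse w ∷ʳ y) ∷ʳ (y xor x)     ≡⟨ cong₂ _∷ʳ_ (cong differences (sym (unfold-reverse y w))) (xor-comm y x) ⟩
  differences (reverse (y ∷ w)) ∷ʳ (x xor y)    ≡⟨ cong (_∷ʳ (x xor y)) (differences-reverse (y ∷ w)) ⟩
  reverse (differences (y ∷ w)) ∷ʳ (x xor y)    ≡⟨ sym (unfold-reverse (x xor y) (differences (y ∷ w))) ⟩
  reverse (differences (x ∷ y ∷ w))             ∎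
  where
  reverse-x∷y∷w : reverse (x ∷ y ∷ w) ≡ reverse w ∷ʳ y ∷ʳ x
  reverse-x∷y∷w = trans (unfold-reverse x (y ∷ w)) (cong (_∷ʳ x) (unfold-reverse y w))

differences-act : ∀ h w → differences (act h w) ≡ differences w ⊎ differences (act h w) ≡ reverse (differences w)
differences-act idH w = inj₁ refl
differences-act RH  w = inj₂ (differences-reverse w)
differences-act EH  w = inj₂ (trans (differences-reverse (map not w)) (cong reverse (differences-map-not w)))
differences-act REH w = inj₁ (trans (cong differences (reverse-involutive (map not w))) (differences-map-not w))

module _ {u v : InfWord} (Su≡v : ∀ i → S u i ≡ v i) where

  u-suc : ∀ i → u (suc i) ≡ u i xor v i
  u-suc i = trans (sym (xor-cancelˡ (u i) (u (suc i)))) (cong (u i xor_) (Su≡v i))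

  slice-scanl : ∀ i n → slice u i (suc n) ≡ scanl _xor_ (u i) (slice v i n)
  slice-scanl i zero    = refl
  slice-scanl i (suc n) = cong (u i ∷_) (begin
    slice u (suc i) (suc n)                             ≡⟨ slice-scanl (suc i) n ⟩
    scanl _xor_ (u (suc i)) (slice v (suc i) n)         ≡⟨ cong (λ b → scanl _xor_ b _) (u-suc i) ⟩
    scanl _xor_ (u i xor v i) (slice v (suc i) n)       ∎)

  u-+-parity : ∀ n j → u (n + j) ≡ u j xor parity true (slice v j n)
  u-+-parity zero    j = sym (xor-identityʳ (u j))
  u-+-parity (suc n) j = begin
    u (suc (n + j))                                          ≡⟨ cong u (sym (+-suc n j)) ⟩
    u (n + suc j)                                            ≡⟨ u-+-parity n (suc j) ⟩
    u (suc j) xor parity true (slice v (suc j) n)            ≡⟨ cong (_xor _) (u-suc j) ⟩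
    (u j xor v j) xor parity true (slice v (suc j) n)        ≡⟨ xor-assoc (u j) (v j) _ ⟩
    u j xor (v j xor parity true (slice v (suc j) n))        ≡⟨ cong (u j xor_) (sym (parity-true-∷ (v j) _)) ⟩
    u j xor parity true (slice v j (suc n))                  ∎

  differences-factor : ∀ w → Factor w u → Factor (differences w) v
  differences-factor []      _       = 0 , refl
  differences-factor (x ∷ w) (j , eq) = j , (begin
    slice v j (length (differences (x ∷ w)))                 ≡⟨ cong (slice v j) (length-differences x w) ⟩
    slice v j (length w)                                     ≡⟨ sym (differences-scanl (u j) _) ⟩
    differences (scanl _xor_ (u j) (slice v j (length w)))   ≡⟨ cong differences (sym (slice-scanl j (length w))) ⟩
    differences (slice u j (suc (length w)))                 ≡⟨ cong differences eq ⟩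
    differences (x ∷ w)                                      ∎)

  module _ (welldoc : WELLDOC2 v) where

    scanl-factor : ∀ b s → Factor s v → Factor (scanl _xor_ b s) u
    scanl-factor b s s∈v with welldoc s s∈v false (u 0 xor b)
    ... | i , occurs , _ , odd-ones = i , (begin
      slice u i (length (scanl _xor_ b s))     ≡⟨ cong (slice u i) (length-scanl _xor_ b s) ⟩
      slice u i (suc (length s))               ≡⟨ slice-scanl i (length s) ⟩
      scanl _xor_ (u i) (slice v i (length s)) ≡⟨ cong₂ (scanl _xor_) ui≡b occurs ⟩
      scanl _xor_ b s                          ∎)
      where
      ui≡b : u i ≡ b
      ui≡b = begin
        u i                                      ≡⟨ cong u (sym (+-identityʳ i)) ⟩
        u (i + 0)                                ≡⟨ u-+-parity i 0 ⟩
        u 0 xor parity true (slice v 0 i)        ≡⟨ cong (u 0 xor_) odd-ones ⟩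
        u 0 xor (u 0 xor b)                      ≡⟨ xor-cancelˡ (u 0) b ⟩
        b                                        ∎

    factor-of-differences : ∀ w → Factor (differences w) v → Factor w u
    factor-of-differences []      _  = 0 , refl
    factor-of-differences (x ∷ w) Δ∈v =
      subst (λ z → Factor z u) (scanl-differences x w) (scanl-factor x (differences (x ∷ w)) Δ∈v)

mainTheorem6 : (v u : InfWord) → WELLDOC2 v → ClosedUnder R v → (∀ i → S u i ≡ v i) →
    (h : H) → ClosedUnder (act h) u
mainTheorem6 v u welldoc closedR Su≡v h w w∈u =
  factor-of-differences Su≡v welldoc (act h w) Δhw∈v
  where
  Δw∈v : Factor (differences w) v
  Δw∈v = differences-factor Su≡v w w∈u

  Δhw∈v : Factor (differences (act h w)) v
  Δhw∈v with differences-act h w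
  ... | inj₁ eq = subst (λ z → Factor z v) (sym eq) Δw∈v
  ... | inj₂ eq = subst (λ z → Factor z v) (sym eq) (closedR (differences w) Δw∈v)
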